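{- Let $\mathcal{Q}=(Q,\rho)$ be a quasimetric space with betweenness $\mathcal{B}$. For any four pairwise distinct points $w,x,y,z\in Q$: (i) if $wxy,\ ywz,\ zyx,\ xzw\in\mathcal{B}$, then $wzy,\ yxz,\ zwx,\ xyw\in\mathcal{B}$; (ii) if $wxy,\ yzx,\ xwz,\ zyw\in\mathcal{B}$, then $wzy,\ ywx,\ xyz,\ zxw\in\mathcal{B}$; (iii) if $wxy,\ yzw,\ xwz,\ zyx\in\mathcal{B}$, then $wzy,\ yxw,\ xyz,\ zwx\in\mathcal{B}$.
   Context: A quasimetric space is a pair $(Q,\rho)$ where $Q$ is a set and $\rho:Q\times Q\to[0,\infty)$ satisfies $\rho(x,y)=0\iff x=y$ and $\rho(x,y)\le \rho(x,z)+\rho(z,y)$ for all $x,y,z\in Q$ ($\rho$ need not be symmetric). The betweenness $\mathcal{B}$ of $(Q,\rho)$ is the set of ordered triples $(a,b,c)$ of pairwise distinct points of $Q$ with $\rho(a,b)+\rho(b,c)=\rho(a,c)$; the triple $(a,b,c)$ is written $abc$. -}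

module Defs where

open import Level using (0ℓ)
open import Data.Product using (Σ; _×_; _,_)
open import Data.Sum using (_⊎_)
open import Relation.Binary.PropositionalEquality using (_≡_)
open import Relation.Nullary using (¬_)

-- The real numbers, axiomatised as a complete ordered field
-- (any model is isomorphic to ℝ).  agda-stdlib has no reals.
record RealField : Set₁ where
  infixl 6 _+_
  infixl 7 _*_
  infix 4 _≤_
  field
    ℝ : Set
    0ℝ 1ℝ : ℝ
    _+_ _*_ : ℝ → ℝ → ℝ
    -_ : ℝ → ℝ
    _≤_ : ℝ → ℝ → Set
    +-assoc : ∀ x y z → (x + y) + z ≡ x + (y + z)
    +-comm : ∀ x y → x + y ≡ y + x
    +-identityˡ : ∀ x → 0ℝ + x ≡ x
    +-inverseˡ : ∀ x → (- x) + x ≡ 0ℝ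
    *-assoc : ∀ x y z → (x * y) * z ≡ x * (y * z)
    *-comm : ∀ x y → x * y ≡ y * x
    *-identityˡ : ∀ x → 1ℝ * x ≡ x
    *-inverseˡ : ∀ x → ¬ (x ≡ 0ℝ) → Σ ℝ (λ y → y * x ≡ 1ℝ)
    distribˡ : ∀ x y z → x * (y + z) ≡ x * y + x * z
    0≢1 : ¬ (0ℝ ≡ 1ℝ)
    ≤-refl : ∀ x → x ≤ x
    ≤-trans : ∀ {x y z} → x ≤ y → y ≤ z → x ≤ z
    ≤-antisym : ∀ {x y} → x ≤ y → y ≤ x → x ≡ y
    ≤-total : ∀ x y → (x ≤ y) ⊎ (y ≤ x)
    +-mono-≤ : ∀ {x y} z → x ≤ y → x + z ≤ y + z
    *-nonneg : ∀ {x y} → 0ℝ ≤ x → 0ℝ ≤ y → 0ℝ ≤ x * y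
    lub : (P : ℝ → Set) → Σ ℝ P → Σ ℝ (λ b → ∀ x → P x → x ≤ b) →
          Σ ℝ (λ s → (∀ x → P x → x ≤ s) × (∀ b → (∀ x → P x → x ≤ b) → s ≤ b))

module _ (R : RealField) where
  open RealField R

  record IsQuasimetric {Q : Set} (ρ : Q → Q → ℝ) : Set where
    field
      nonneg : ∀ x y → 0ℝ ≤ ρ x y
      zero⇒eq : ∀ x y → ρ x y ≡ 0ℝ → x ≡ y
      eq⇒zero : ∀ x → ρ x x ≡ 0ℝ
      triangle : ∀ x y z → ρ x y ≤ ρ x z + ρ z y

  Between : {Q : Set} (ρ : Q → Q → ℝ) → Q → Q → Q → Set
  Between ρ a b c =
    ¬ (a ≡ b) × ¬ (b ≡ c) × ¬ (a ≡ c) × (ρ a b + ρ b c ≡ ρ a c)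

-- In each of the three configurations the i-th conclusion triple has the same
-- endpoints as the i-th hypothesis triple, and the middle points are rearranged so
-- that the eight legs ρ(a,b), ρ(b,c) of the conclusions are exactly the eight legs of
-- the hypotheses.  Hence the total detour of the conclusion triples equals their total
-- direct distance, while the triangle inequality bounds each direct distance by its
-- detour: all four inequalities must be equalities.
module Submission where

open import Defs
open import Algebra.Bundles using (CommutativeMonoid)
import Algebra.Solver.CommutativeMonoid
open import Data.List using (List; []; _∷_; foldr; map)
open import Data.List.Relation.Unary.All as All using (All; []; _∷_)
open import Data.Product using (_×_; _,_)
open import Relation.Binary.PropositionalEquality
  using (_≡_; refl; sym; trans; cong; cong₂; subst; isEquivalence; ≢-sym; module ≡-Reasoning)
open import Relation.Nullary using (¬_)

module OrderedAddition (R : RealField) where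
  open RealField R

  +-identityʳ : ∀ x → x + 0ℝ ≡ x
  +-identityʳ x = trans (+-comm x 0ℝ) (+-identityˡ x)

  +-inverseʳ : ∀ x → x + (- x) ≡ 0ℝ
  +-inverseʳ x = trans (+-comm x (- x)) (+-inverseˡ x)

  +-0-commutativeMonoid : CommutativeMonoid _ _
  +-0-commutativeMonoid = record
    { Carrier = ℝ ; _≈_ = _≡_ ; _∙_ = _+_ ; ε = 0ℝ
    ; isCommutativeMonoid = record
      { isMonoid = record
        { isSemigroup = record
          { isMagma = record { isEquivalence = isEquivalence ; ∙-cong = cong₂ _+_ }
          ; assoc = +-assoc }
        ; identity = +-identityˡ , +-identityʳ }
      ; comm = +-comm } }

  +-cancelʳ : ∀ z x → (x + z) + (- z) ≡ x
  +-cancelʳ z x = begin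
    (x + z) + (- z)  ≡⟨ +-assoc x z (- z) ⟩
    x + (z + (- z))  ≡⟨ cong (x +_) (+-inverseʳ z) ⟩
    x + 0ℝ           ≡⟨ +-identityʳ x ⟩
    x                ∎
    where open ≡-Reasoning

  ≤-resp₂ : ∀ {a b c d} → a ≡ b → c ≡ d → a ≤ c → b ≤ d
  ≤-resp₂ refl refl a≤c = a≤c

  +-cancelʳ-≤ : ∀ {x y} z → x + z ≤ y + z → x ≤ y
  +-cancelʳ-≤ {x} {y} z x+z≤y+z =
    ≤-resp₂ (+-cancelʳ z x) (+-cancelʳ z y) (+-mono-≤ (- z) x+z≤y+z)

  +-monoʳ-≤ : ∀ {x y} z → x ≤ y → z + x ≤ z + y
  +-monoʳ-≤ {x} {y} z x≤y = ≤-resp₂ (+-comm x z) (+-comm y z) (+-mono-≤ z x≤y)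

  +-mono₂-≤ : ∀ {x x′ y y′} → x ≤ x′ → y ≤ y′ → x + y ≤ x′ + y′
  +-mono₂-≤ {x′ = x′} {y = y} x≤x′ y≤y′ = ≤-trans (+-mono-≤ y x≤x′) (+-monoʳ-≤ x′ y≤y′)

  +-squeezeˡ : ∀ {x x′ y y′} → x ≤ x′ → y ≤ y′ → x′ + y′ ≡ x + y → x ≡ x′
  +-squeezeˡ {x} {x′} {y} x≤x′ y≤y′ sums≡ =
    ≤-antisym x≤x′ (+-cancelʳ-≤ y (subst (x′ + y ≤_) sums≡ (+-monoʳ-≤ x′ y≤y′)))

  +-squeeze : ∀ {x x′ y y′} → x ≤ x′ → y ≤ y′ → x′ + y′ ≡ x + y → x ≡ x′ × y ≡ y′
  +-squeeze {x} {x′} {y} {y′} x≤x′ y≤y′ sums≡ =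
    +-squeezeˡ x≤x′ y≤y′ sums≡ ,
    +-squeezeˡ y≤y′ x≤x′ (trans (+-comm y′ x′) (trans sums≡ (+-comm x y)))

  sum : List ℝ → ℝ
  sum = foldr _+_ 0ℝ

  sum-mono : ∀ {A : Set} (f g : A → ℝ) → (∀ a → f a ≤ g a) →
    ∀ as → sum (map f as) ≤ sum (map g as)
  sum-mono f g f≤g []       = ≤-refl 0ℝ
  sum-mono f g f≤g (a ∷ as) = +-mono₂-≤ (f≤g a) (sum-mono f g f≤g as)

  sum-squeeze : ∀ {A : Set} (f g : A → ℝ) → (∀ a → f a ≤ g a) →
    ∀ as → sum (map g as) ≡ sum (map f as) → All (λ a → f a ≡ g a) as
  sum-squeeze f g f≤g []       _     = []
  sum-squeeze f g f≤g (a ∷ as) sums≡ with +-squeeze (f≤g a) (sum-mono f g f≤g as) sums≡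
  ... | head≡ , tail≡ = head≡ ∷ sum-squeeze f g f≤g as (sym tail≡)

module Detours (R : RealField) {Q : Set} {ρ : Q → Q → RealField.ℝ R} (qm : IsQuasimetric R ρ) where
  open RealField R
  open OrderedAddition R
  open IsQuasimetric qm

  Triple : Set
  Triple = Q × Q × Q

  detour : Triple → ℝ
  detour (a , b , c) = ρ a b + ρ b c

  direct : Triple → ℝ
  direct (a , b , c) = ρ a c

  Tight : Triple → Set
  Tight t = detour t ≡ direct t

  direct≤detour : ∀ t → direct t ≤ detour t
  direct≤detour (a , b , c) = triangle a c b

  sum-detour≡sum-direct : ∀ {ts} → All Tight ts → sum (map detour ts) ≡ sum (map direct ts)
  sum-detour≡sum-direct []               = refl
  sum-detour≡sum-direct (tight ∷ tights) = cong₂ _+_ tight (sum-detour≡sum-direct tights)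

  tight-transfer : ∀ {ts} us → All Tight ts →
    sum (map direct us) ≡ sum (map direct ts) →
    sum (map detour us) ≡ sum (map detour ts) →
    All Tight us
  tight-transfer {ts} us tights directs≡ detours≡ =
    All.map sym (sum-squeeze direct detour direct≤detour us (begin
      sum (map detour us)  ≡⟨ detours≡ ⟩
      sum (map detour ts)  ≡⟨ sum-detour≡sum-direct tights ⟩
      sum (map direct ts)  ≡⟨ directs≡ ⟨
      sum (map direct us)  ∎))
    where open ≡-Reasoning

module FourPoints (R : RealField) {Q : Set} {ρ : Q → Q → RealField.ℝ R} (qm : IsQuasimetric R ρ)
  {w x y z : Q} (w≢x : ¬ (w ≡ x)) (w≢y : ¬ (w ≡ y)) (w≢z : ¬ (w ≡ z))
  (x≢y : ¬ (x ≡ y)) (x≢z : ¬ (x ≡ z)) (y≢z : ¬ (y ≡ z)) where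
  open Detours R qm
  open Algebra.Solver.CommutativeMonoid (OrderedAddition.+-0-commutativeMonoid R)
    using (solve; _⊜_; _⊕_; id)

  part-i : Between R ρ w x y × Between R ρ y w z × Between R ρ z y x × Between R ρ x z w →
           Between R ρ w z y × Between R ρ y x z × Between R ρ z w x × Between R ρ x y w
  part-i ((_ , _ , _ , wxy) , (_ , _ , _ , ywz) , (_ , _ , _ , zyx) , (_ , _ , _ , xzw))
    with tight-transfer ((w , z , y) ∷ (y , x , z) ∷ (z , w , x) ∷ (x , y , w) ∷ [])
           (wxy ∷ ywz ∷ zyx ∷ xzw ∷ []) refl
           (solve 8 (λ wx xy yw wz zy yx xz zw →
              (wz ⊕ zy) ⊕ (yx ⊕ xz) ⊕ (zw ⊕ wx) ⊕ (xy ⊕ yw) ⊕ id ⊜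
              (wx ⊕ xy) ⊕ (yw ⊕ wz) ⊕ (zy ⊕ yx) ⊕ (xz ⊕ zw) ⊕ id) refl
              (ρ w x) (ρ x y) (ρ y w) (ρ w z) (ρ z y) (ρ y x) (ρ x z) (ρ z w))
  ... | wzy ∷ yxz ∷ zwx ∷ xyw ∷ [] =
    (w≢z , ≢-sym y≢z , w≢y , wzy) , (≢-sym x≢y , x≢z , y≢z , yxz) ,
    (≢-sym w≢z , w≢x , ≢-sym x≢z , zwx) , (x≢y , ≢-sym w≢y , ≢-sym w≢x , xyw)

  part-ii : Between R ρ w x y × Between R ρ y z x × Between R ρ x w z × Between R ρ z y w →
            Between R ρ w z y × Between R ρ y w x × Between R ρ x y z × Between R ρ z x w
  part-ii ((_ , _ , _ , wxy) , (_ , _ , _ , yzx) , (_ , _ , _ , xwz) , (_ , _ , _ , zyw))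
    with tight-transfer ((w , z , y) ∷ (y , w , x) ∷ (x , y , z) ∷ (z , x , w) ∷ [])
           (wxy ∷ yzx ∷ xwz ∷ zyw ∷ []) refl
           (solve 8 (λ wx xy yz zx xw wz zy yw →
              (wz ⊕ zy) ⊕ (yw ⊕ wx) ⊕ (xy ⊕ yz) ⊕ (zx ⊕ xw) ⊕ id ⊜
              (wx ⊕ xy) ⊕ (yz ⊕ zx) ⊕ (xw ⊕ wz) ⊕ (zy ⊕ yw) ⊕ id) refl
              (ρ w x) (ρ x y) (ρ y z) (ρ z x) (ρ x w) (ρ w z) (ρ z y) (ρ y w))
  ... | wzy ∷ ywx ∷ xyz ∷ zxw ∷ [] =
    (w≢z , ≢-sym y≢z , w≢y , wzy) , (≢-sym w≢y , w≢x , ≢-sym x≢y , ywx) ,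
    (x≢y , y≢z , x≢z , xyz) , (≢-sym x≢z , ≢-sym w≢x , ≢-sym w≢z , zxw)

  part-iii : Between R ρ w x y × Between R ρ y z w × Between R ρ x w z × Between R ρ z y x →
             Between R ρ w z y × Between R ρ y x w × Between R ρ x y z × Between R ρ z w x
  part-iii ((_ , _ , _ , wxy) , (_ , _ , _ , yzw) , (_ , _ , _ , xwz) , (_ , _ , _ , zyx))
    with tight-transfer ((w , z , y) ∷ (y , x , w) ∷ (x , y , z) ∷ (z , w , x) ∷ [])
           (wxy ∷ yzw ∷ xwz ∷ zyx ∷ []) refl
           (solve 8 (λ wx xy yz zw xw wz zy yx →
              (wz ⊕ zy) ⊕ (yx ⊕ xw) ⊕ (xy ⊕ yz) ⊕ (zw ⊕ wx) ⊕ id ⊜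
              (wx ⊕ xy) ⊕ (yz ⊕ zw) ⊕ (xw ⊕ wz) ⊕ (zy ⊕ yx) ⊕ id) refl
              (ρ w x) (ρ x y) (ρ y z) (ρ z w) (ρ x w) (ρ w z) (ρ z y) (ρ y x))
  ... | wzy ∷ yxw ∷ xyz ∷ zwx ∷ [] =
    (w≢z , ≢-sym y≢z , w≢y , wzy) , (≢-sym x≢y , ≢-sym w≢x , ≢-sym w≢y , yxw) ,
    (x≢y , y≢z , x≢z , xyz) , (≢-sym w≢z , w≢x , ≢-sym x≢z , zwx)

mainTheorem2 : (R : RealField) (Q : Set) (ρ : Q → Q → RealField.ℝ R) →
    IsQuasimetric R ρ →
    (w x y z : Q) →
    ¬ (w ≡ x) → ¬ (w ≡ y) → ¬ (w ≡ z) → ¬ (x ≡ y) → ¬ (x ≡ z) → ¬ (y ≡ z) →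
    ((Between R ρ w x y × Between R ρ y w z × Between R ρ z y x × Between R ρ x z w) →
       (Between R ρ w z y × Between R ρ y x z × Between R ρ z w x × Between R ρ x y w))
    × ((Between R ρ w x y × Between R ρ y z x × Between R ρ x w z × Between R ρ z y w) →
       (Between R ρ w z y × Between R ρ y w x × Between R ρ x y z × Between R ρ z x w))
    × ((Between R ρ w x y × Between R ρ y z w × Between R ρ x w z × Between R ρ z y x) →
       (Between R ρ w z y × Between R ρ y x w × Between R ρ x y z × Between R ρ z w x))
mainTheorem2 R Q ρ qm w x y z w≢x w≢y w≢z x≢y x≢z y≢z = part-i , part-ii , part-iii
  where open FourPoints R qm w≢x w≢y w≢z x≢y x≢z y≢z
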